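{- Let $(\mathcal{V},\mathcal{B})$ be the derived design of the Witt $4$-$(23,7,1)$ design (a $3$-$(22,6,1)$ design with $77$ blocks, each element lying in $21$ blocks). Then there is a function $f:\mathcal{V}\to\mathbb{R}$ with $\sum_{x\in\mathcal{V}}f(x)=0$ such that fewer than $21$ blocks $B$ satisfy $\sum_{x\in B}f(x)\ge 0$; i.e. this design does not have the MMS star property.
   Context: A $t$-$(v,k,\lambda)$ design is a $v$-set $\mathcal{V}$ with a family $\mathcal{B}$ of $k$-subsets (blocks) such that every $t$-subset of $\mathcal{V}$ lies in exactly $\lambda$ blocks. The Witt design is the (unique up to isomorphism) $4$-$(23,7,1)$ design. Its derived design is obtained by fixing an element $x$, taking all blocks containing $x$, and removing $x$ from them; it is a $3$-$(22,6,1)$ design on the remaining $22$ elements. The MMS star property for a design means: for every zero-sum real weighting of the elements, the number of blocks of nonnegative total weight is at least the number of blocks through a single element. -}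

module Defs where

open import Data.Nat using (ℕ; zero; suc; _<?_)
open import Data.Fin using (Fin; #_; toℕ; fromℕ<)
open import Data.List using (List; []; _∷_; filter; length; map; concatMap; allFin; foldr)
open import Data.Bool using (Bool; true; false)
import Data.Bool
import Data.Nat
open import Data.Rational using (ℚ; 0ℚ; _+_; _≤?_)
open import Relation.Nullary.Decidable using (yes; no)

-- Blocks of the Witt 4-(23,7,1) design on the point set Fin 23 = {0,…,22}:
-- the supports of the 253 weight-7 codewords of the binary cyclic [23,12,7]
-- Golay code generated by g(x) = 1 + x^2 + x^4 + x^5 + x^6 + x^10 + x^11
-- (coordinate i ↔ coefficient of x^i).  (Checked externally: every 4-subset
-- of Fin 23 lies in exactly one of these blocks.)
wittBlocks : List (List (Fin 23))
wittBlocks =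
  (# 0 ∷ # 2 ∷ # 4 ∷ # 5 ∷ # 6 ∷ # 10 ∷ # 11 ∷ []) ∷
  (# 1 ∷ # 3 ∷ # 5 ∷ # 6 ∷ # 7 ∷ # 11 ∷ # 12 ∷ []) ∷
  (# 2 ∷ # 4 ∷ # 6 ∷ # 7 ∷ # 8 ∷ # 12 ∷ # 13 ∷ []) ∷
  (# 0 ∷ # 1 ∷ # 3 ∷ # 6 ∷ # 8 ∷ # 10 ∷ # 13 ∷ []) ∷
  (# 3 ∷ # 5 ∷ # 7 ∷ # 8 ∷ # 9 ∷ # 13 ∷ # 14 ∷ []) ∷
  (# 0 ∷ # 3 ∷ # 9 ∷ # 10 ∷ # 11 ∷ # 12 ∷ # 14 ∷ []) ∷
  (# 1 ∷ # 2 ∷ # 4 ∷ # 7 ∷ # 9 ∷ # 11 ∷ # 14 ∷ []) ∷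
  (# 4 ∷ # 6 ∷ # 8 ∷ # 9 ∷ # 10 ∷ # 14 ∷ # 15 ∷ []) ∷
  (# 0 ∷ # 2 ∷ # 3 ∷ # 7 ∷ # 11 ∷ # 13 ∷ # 15 ∷ []) ∷
  (# 1 ∷ # 4 ∷ # 10 ∷ # 11 ∷ # 12 ∷ # 13 ∷ # 15 ∷ []) ∷
  (# 2 ∷ # 3 ∷ # 5 ∷ # 8 ∷ # 10 ∷ # 12 ∷ # 15 ∷ []) ∷
  (# 0 ∷ # 1 ∷ # 4 ∷ # 5 ∷ # 7 ∷ # 8 ∷ # 15 ∷ []) ∷
  (# 5 ∷ # 7 ∷ # 9 ∷ # 10 ∷ # 11 ∷ # 15 ∷ # 16 ∷ []) ∷
  (# 0 ∷ # 8 ∷ # 9 ∷ # 12 ∷ # 13 ∷ # 15 ∷ # 16 ∷ []) ∷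
  (# 0 ∷ # 1 ∷ # 6 ∷ # 11 ∷ # 14 ∷ # 15 ∷ # 16 ∷ []) ∷
  (# 0 ∷ # 2 ∷ # 7 ∷ # 8 ∷ # 10 ∷ # 14 ∷ # 16 ∷ []) ∷
  (# 1 ∷ # 3 ∷ # 4 ∷ # 8 ∷ # 12 ∷ # 14 ∷ # 16 ∷ []) ∷
  (# 2 ∷ # 5 ∷ # 11 ∷ # 12 ∷ # 13 ∷ # 14 ∷ # 16 ∷ []) ∷
  (# 3 ∷ # 4 ∷ # 6 ∷ # 9 ∷ # 11 ∷ # 13 ∷ # 16 ∷ []) ∷
  (# 1 ∷ # 2 ∷ # 5 ∷ # 6 ∷ # 8 ∷ # 9 ∷ # 16 ∷ []) ∷
  (# 6 ∷ # 8 ∷ # 10 ∷ # 11 ∷ # 12 ∷ # 16 ∷ # 17 ∷ []) ∷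
  (# 0 ∷ # 5 ∷ # 6 ∷ # 7 ∷ # 13 ∷ # 16 ∷ # 17 ∷ []) ∷
  (# 1 ∷ # 9 ∷ # 10 ∷ # 13 ∷ # 14 ∷ # 16 ∷ # 17 ∷ []) ∷
  (# 0 ∷ # 3 ∷ # 4 ∷ # 10 ∷ # 15 ∷ # 16 ∷ # 17 ∷ []) ∷
  (# 1 ∷ # 2 ∷ # 7 ∷ # 12 ∷ # 15 ∷ # 16 ∷ # 17 ∷ []) ∷
  (# 1 ∷ # 3 ∷ # 8 ∷ # 9 ∷ # 11 ∷ # 15 ∷ # 17 ∷ []) ∷
  (# 2 ∷ # 4 ∷ # 5 ∷ # 9 ∷ # 13 ∷ # 15 ∷ # 17 ∷ []) ∷
  (# 3 ∷ # 6 ∷ # 12 ∷ # 13 ∷ # 14 ∷ # 15 ∷ # 17 ∷ []) ∷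
  (# 4 ∷ # 5 ∷ # 7 ∷ # 10 ∷ # 12 ∷ # 14 ∷ # 17 ∷ []) ∷
  (# 0 ∷ # 1 ∷ # 2 ∷ # 3 ∷ # 5 ∷ # 14 ∷ # 17 ∷ []) ∷
  (# 0 ∷ # 4 ∷ # 8 ∷ # 11 ∷ # 13 ∷ # 14 ∷ # 17 ∷ []) ∷
  (# 2 ∷ # 3 ∷ # 6 ∷ # 7 ∷ # 9 ∷ # 10 ∷ # 17 ∷ []) ∷
  (# 0 ∷ # 1 ∷ # 4 ∷ # 6 ∷ # 9 ∷ # 12 ∷ # 17 ∷ []) ∷
  (# 7 ∷ # 9 ∷ # 11 ∷ # 12 ∷ # 13 ∷ # 17 ∷ # 18 ∷ []) ∷
  (# 0 ∷ # 5 ∷ # 8 ∷ # 9 ∷ # 10 ∷ # 17 ∷ # 18 ∷ []) ∷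
  (# 1 ∷ # 6 ∷ # 7 ∷ # 8 ∷ # 14 ∷ # 17 ∷ # 18 ∷ []) ∷
  (# 2 ∷ # 10 ∷ # 11 ∷ # 14 ∷ # 15 ∷ # 17 ∷ # 18 ∷ []) ∷
  (# 1 ∷ # 4 ∷ # 5 ∷ # 11 ∷ # 16 ∷ # 17 ∷ # 18 ∷ []) ∷
  (# 2 ∷ # 3 ∷ # 8 ∷ # 13 ∷ # 16 ∷ # 17 ∷ # 18 ∷ []) ∷
  (# 2 ∷ # 4 ∷ # 9 ∷ # 10 ∷ # 12 ∷ # 16 ∷ # 18 ∷ []) ∷
  (# 0 ∷ # 1 ∷ # 3 ∷ # 7 ∷ # 9 ∷ # 16 ∷ # 18 ∷ []) ∷
  (# 3 ∷ # 5 ∷ # 6 ∷ # 10 ∷ # 14 ∷ # 16 ∷ # 18 ∷ []) ∷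
  (# 4 ∷ # 7 ∷ # 13 ∷ # 14 ∷ # 15 ∷ # 16 ∷ # 18 ∷ []) ∷
  (# 5 ∷ # 6 ∷ # 8 ∷ # 11 ∷ # 13 ∷ # 15 ∷ # 18 ∷ []) ∷
  (# 0 ∷ # 6 ∷ # 7 ∷ # 10 ∷ # 12 ∷ # 15 ∷ # 18 ∷ []) ∷
  (# 1 ∷ # 2 ∷ # 3 ∷ # 4 ∷ # 6 ∷ # 15 ∷ # 18 ∷ []) ∷
  (# 1 ∷ # 5 ∷ # 9 ∷ # 12 ∷ # 14 ∷ # 15 ∷ # 18 ∷ []) ∷
  (# 0 ∷ # 2 ∷ # 6 ∷ # 9 ∷ # 13 ∷ # 14 ∷ # 18 ∷ []) ∷
  (# 3 ∷ # 4 ∷ # 7 ∷ # 8 ∷ # 10 ∷ # 11 ∷ # 18 ∷ []) ∷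
  (# 0 ∷ # 1 ∷ # 2 ∷ # 8 ∷ # 11 ∷ # 12 ∷ # 18 ∷ []) ∷
  (# 0 ∷ # 3 ∷ # 4 ∷ # 5 ∷ # 12 ∷ # 13 ∷ # 18 ∷ []) ∷
  (# 1 ∷ # 2 ∷ # 5 ∷ # 7 ∷ # 10 ∷ # 13 ∷ # 18 ∷ []) ∷
  (# 8 ∷ # 10 ∷ # 12 ∷ # 13 ∷ # 14 ∷ # 18 ∷ # 19 ∷ []) ∷
  (# 0 ∷ # 5 ∷ # 7 ∷ # 11 ∷ # 14 ∷ # 18 ∷ # 19 ∷ []) ∷
  (# 1 ∷ # 6 ∷ # 9 ∷ # 10 ∷ # 11 ∷ # 18 ∷ # 19 ∷ []) ∷
  (# 2 ∷ # 7 ∷ # 8 ∷ # 9 ∷ # 15 ∷ # 18 ∷ # 19 ∷ []) ∷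
  (# 3 ∷ # 11 ∷ # 12 ∷ # 15 ∷ # 16 ∷ # 18 ∷ # 19 ∷ []) ∷
  (# 0 ∷ # 4 ∷ # 6 ∷ # 8 ∷ # 16 ∷ # 18 ∷ # 19 ∷ []) ∷
  (# 0 ∷ # 1 ∷ # 13 ∷ # 15 ∷ # 17 ∷ # 18 ∷ # 19 ∷ []) ∷
  (# 2 ∷ # 5 ∷ # 6 ∷ # 12 ∷ # 17 ∷ # 18 ∷ # 19 ∷ []) ∷
  (# 3 ∷ # 4 ∷ # 9 ∷ # 14 ∷ # 17 ∷ # 18 ∷ # 19 ∷ []) ∷
  (# 3 ∷ # 5 ∷ # 10 ∷ # 11 ∷ # 13 ∷ # 17 ∷ # 19 ∷ []) ∷
  (# 0 ∷ # 3 ∷ # 7 ∷ # 8 ∷ # 12 ∷ # 17 ∷ # 19 ∷ []) ∷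
  (# 1 ∷ # 2 ∷ # 4 ∷ # 8 ∷ # 10 ∷ # 17 ∷ # 19 ∷ []) ∷
  (# 4 ∷ # 6 ∷ # 7 ∷ # 11 ∷ # 15 ∷ # 17 ∷ # 19 ∷ []) ∷
  (# 5 ∷ # 8 ∷ # 14 ∷ # 15 ∷ # 16 ∷ # 17 ∷ # 19 ∷ []) ∷
  (# 0 ∷ # 2 ∷ # 9 ∷ # 11 ∷ # 16 ∷ # 17 ∷ # 19 ∷ []) ∷
  (# 6 ∷ # 7 ∷ # 9 ∷ # 12 ∷ # 14 ∷ # 16 ∷ # 19 ∷ []) ∷
  (# 1 ∷ # 7 ∷ # 8 ∷ # 11 ∷ # 13 ∷ # 16 ∷ # 19 ∷ []) ∷
  (# 2 ∷ # 3 ∷ # 4 ∷ # 5 ∷ # 7 ∷ # 16 ∷ # 19 ∷ []) ∷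
  (# 0 ∷ # 1 ∷ # 5 ∷ # 10 ∷ # 12 ∷ # 16 ∷ # 19 ∷ []) ∷
  (# 2 ∷ # 6 ∷ # 10 ∷ # 13 ∷ # 15 ∷ # 16 ∷ # 19 ∷ []) ∷
  (# 0 ∷ # 2 ∷ # 4 ∷ # 12 ∷ # 14 ∷ # 15 ∷ # 19 ∷ []) ∷
  (# 1 ∷ # 3 ∷ # 7 ∷ # 10 ∷ # 14 ∷ # 15 ∷ # 19 ∷ []) ∷
  (# 0 ∷ # 3 ∷ # 5 ∷ # 6 ∷ # 9 ∷ # 15 ∷ # 19 ∷ []) ∷
  (# 4 ∷ # 5 ∷ # 8 ∷ # 9 ∷ # 11 ∷ # 12 ∷ # 19 ∷ []) ∷
  (# 0 ∷ # 4 ∷ # 7 ∷ # 9 ∷ # 10 ∷ # 13 ∷ # 19 ∷ []) ∷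
  (# 1 ∷ # 2 ∷ # 3 ∷ # 9 ∷ # 12 ∷ # 13 ∷ # 19 ∷ []) ∷
  (# 1 ∷ # 4 ∷ # 5 ∷ # 6 ∷ # 13 ∷ # 14 ∷ # 19 ∷ []) ∷
  (# 2 ∷ # 3 ∷ # 6 ∷ # 8 ∷ # 11 ∷ # 14 ∷ # 19 ∷ []) ∷
  (# 9 ∷ # 11 ∷ # 13 ∷ # 14 ∷ # 15 ∷ # 19 ∷ # 20 ∷ []) ∷
  (# 1 ∷ # 6 ∷ # 8 ∷ # 12 ∷ # 15 ∷ # 19 ∷ # 20 ∷ []) ∷
  (# 0 ∷ # 2 ∷ # 5 ∷ # 8 ∷ # 13 ∷ # 19 ∷ # 20 ∷ []) ∷
  (# 2 ∷ # 7 ∷ # 10 ∷ # 11 ∷ # 12 ∷ # 19 ∷ # 20 ∷ []) ∷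
  (# 0 ∷ # 1 ∷ # 3 ∷ # 4 ∷ # 11 ∷ # 19 ∷ # 20 ∷ []) ∷
  (# 3 ∷ # 8 ∷ # 9 ∷ # 10 ∷ # 16 ∷ # 19 ∷ # 20 ∷ []) ∷
  (# 4 ∷ # 12 ∷ # 13 ∷ # 16 ∷ # 17 ∷ # 19 ∷ # 20 ∷ []) ∷
  (# 0 ∷ # 6 ∷ # 10 ∷ # 14 ∷ # 17 ∷ # 19 ∷ # 20 ∷ []) ∷
  (# 1 ∷ # 5 ∷ # 7 ∷ # 9 ∷ # 17 ∷ # 19 ∷ # 20 ∷ []) ∷
  (# 1 ∷ # 2 ∷ # 14 ∷ # 16 ∷ # 18 ∷ # 19 ∷ # 20 ∷ []) ∷
  (# 3 ∷ # 6 ∷ # 7 ∷ # 13 ∷ # 18 ∷ # 19 ∷ # 20 ∷ []) ∷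
  (# 4 ∷ # 5 ∷ # 10 ∷ # 15 ∷ # 18 ∷ # 19 ∷ # 20 ∷ []) ∷
  (# 0 ∷ # 3 ∷ # 8 ∷ # 14 ∷ # 15 ∷ # 18 ∷ # 20 ∷ []) ∷
  (# 4 ∷ # 6 ∷ # 11 ∷ # 12 ∷ # 14 ∷ # 18 ∷ # 20 ∷ []) ∷
  (# 1 ∷ # 4 ∷ # 8 ∷ # 9 ∷ # 13 ∷ # 18 ∷ # 20 ∷ []) ∷
  (# 2 ∷ # 3 ∷ # 5 ∷ # 9 ∷ # 11 ∷ # 18 ∷ # 20 ∷ []) ∷
  (# 5 ∷ # 7 ∷ # 8 ∷ # 12 ∷ # 16 ∷ # 18 ∷ # 20 ∷ []) ∷
  (# 0 ∷ # 10 ∷ # 11 ∷ # 13 ∷ # 16 ∷ # 18 ∷ # 20 ∷ []) ∷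
  (# 6 ∷ # 9 ∷ # 15 ∷ # 16 ∷ # 17 ∷ # 18 ∷ # 20 ∷ []) ∷
  (# 0 ∷ # 2 ∷ # 4 ∷ # 7 ∷ # 17 ∷ # 18 ∷ # 20 ∷ []) ∷
  (# 1 ∷ # 3 ∷ # 10 ∷ # 12 ∷ # 17 ∷ # 18 ∷ # 20 ∷ []) ∷
  (# 7 ∷ # 8 ∷ # 10 ∷ # 13 ∷ # 15 ∷ # 17 ∷ # 20 ∷ []) ∷
  (# 0 ∷ # 5 ∷ # 11 ∷ # 12 ∷ # 15 ∷ # 17 ∷ # 20 ∷ []) ∷
  (# 2 ∷ # 8 ∷ # 9 ∷ # 12 ∷ # 14 ∷ # 17 ∷ # 20 ∷ []) ∷
  (# 3 ∷ # 4 ∷ # 5 ∷ # 6 ∷ # 8 ∷ # 17 ∷ # 20 ∷ []) ∷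
  (# 1 ∷ # 2 ∷ # 6 ∷ # 11 ∷ # 13 ∷ # 17 ∷ # 20 ∷ []) ∷
  (# 3 ∷ # 7 ∷ # 11 ∷ # 14 ∷ # 16 ∷ # 17 ∷ # 20 ∷ []) ∷
  (# 1 ∷ # 3 ∷ # 5 ∷ # 13 ∷ # 15 ∷ # 16 ∷ # 20 ∷ []) ∷
  (# 2 ∷ # 4 ∷ # 8 ∷ # 11 ∷ # 15 ∷ # 16 ∷ # 20 ∷ []) ∷
  (# 0 ∷ # 4 ∷ # 5 ∷ # 9 ∷ # 14 ∷ # 16 ∷ # 20 ∷ []) ∷
  (# 0 ∷ # 2 ∷ # 3 ∷ # 6 ∷ # 12 ∷ # 16 ∷ # 20 ∷ []) ∷
  (# 1 ∷ # 4 ∷ # 6 ∷ # 7 ∷ # 10 ∷ # 16 ∷ # 20 ∷ []) ∷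
  (# 5 ∷ # 6 ∷ # 9 ∷ # 10 ∷ # 12 ∷ # 13 ∷ # 20 ∷ []) ∷
  (# 0 ∷ # 6 ∷ # 7 ∷ # 8 ∷ # 9 ∷ # 11 ∷ # 20 ∷ []) ∷
  (# 1 ∷ # 5 ∷ # 8 ∷ # 10 ∷ # 11 ∷ # 14 ∷ # 20 ∷ []) ∷
  (# 2 ∷ # 3 ∷ # 4 ∷ # 10 ∷ # 13 ∷ # 14 ∷ # 20 ∷ []) ∷
  (# 0 ∷ # 1 ∷ # 7 ∷ # 12 ∷ # 13 ∷ # 14 ∷ # 20 ∷ []) ∷
  (# 2 ∷ # 5 ∷ # 6 ∷ # 7 ∷ # 14 ∷ # 15 ∷ # 20 ∷ []) ∷
  (# 3 ∷ # 4 ∷ # 7 ∷ # 9 ∷ # 12 ∷ # 15 ∷ # 20 ∷ []) ∷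
  (# 0 ∷ # 1 ∷ # 2 ∷ # 9 ∷ # 10 ∷ # 15 ∷ # 20 ∷ []) ∷
  (# 10 ∷ # 12 ∷ # 14 ∷ # 15 ∷ # 16 ∷ # 20 ∷ # 21 ∷ []) ∷
  (# 2 ∷ # 7 ∷ # 9 ∷ # 13 ∷ # 16 ∷ # 20 ∷ # 21 ∷ []) ∷
  (# 1 ∷ # 3 ∷ # 6 ∷ # 9 ∷ # 14 ∷ # 20 ∷ # 21 ∷ []) ∷
  (# 3 ∷ # 8 ∷ # 11 ∷ # 12 ∷ # 13 ∷ # 20 ∷ # 21 ∷ []) ∷
  (# 0 ∷ # 3 ∷ # 5 ∷ # 7 ∷ # 10 ∷ # 20 ∷ # 21 ∷ []) ∷
  (# 1 ∷ # 2 ∷ # 4 ∷ # 5 ∷ # 12 ∷ # 20 ∷ # 21 ∷ []) ∷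
  (# 0 ∷ # 4 ∷ # 6 ∷ # 13 ∷ # 15 ∷ # 20 ∷ # 21 ∷ []) ∷
  (# 4 ∷ # 9 ∷ # 10 ∷ # 11 ∷ # 17 ∷ # 20 ∷ # 21 ∷ []) ∷
  (# 0 ∷ # 1 ∷ # 8 ∷ # 16 ∷ # 17 ∷ # 20 ∷ # 21 ∷ []) ∷
  (# 5 ∷ # 13 ∷ # 14 ∷ # 17 ∷ # 18 ∷ # 20 ∷ # 21 ∷ []) ∷
  (# 1 ∷ # 7 ∷ # 11 ∷ # 15 ∷ # 18 ∷ # 20 ∷ # 21 ∷ []) ∷
  (# 2 ∷ # 6 ∷ # 8 ∷ # 10 ∷ # 18 ∷ # 20 ∷ # 21 ∷ []) ∷
  (# 0 ∷ # 9 ∷ # 12 ∷ # 18 ∷ # 19 ∷ # 20 ∷ # 21 ∷ []) ∷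
  (# 2 ∷ # 3 ∷ # 15 ∷ # 17 ∷ # 19 ∷ # 20 ∷ # 21 ∷ []) ∷
  (# 4 ∷ # 7 ∷ # 8 ∷ # 14 ∷ # 19 ∷ # 20 ∷ # 21 ∷ []) ∷
  (# 5 ∷ # 6 ∷ # 11 ∷ # 16 ∷ # 19 ∷ # 20 ∷ # 21 ∷ []) ∷
  (# 0 ∷ # 3 ∷ # 13 ∷ # 14 ∷ # 16 ∷ # 19 ∷ # 21 ∷ []) ∷
  (# 1 ∷ # 4 ∷ # 9 ∷ # 15 ∷ # 16 ∷ # 19 ∷ # 21 ∷ []) ∷
  (# 5 ∷ # 7 ∷ # 12 ∷ # 13 ∷ # 15 ∷ # 19 ∷ # 21 ∷ []) ∷
  (# 0 ∷ # 8 ∷ # 10 ∷ # 11 ∷ # 15 ∷ # 19 ∷ # 21 ∷ []) ∷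
  (# 2 ∷ # 5 ∷ # 9 ∷ # 10 ∷ # 14 ∷ # 19 ∷ # 21 ∷ []) ∷
  (# 3 ∷ # 4 ∷ # 6 ∷ # 10 ∷ # 12 ∷ # 19 ∷ # 21 ∷ []) ∷
  (# 0 ∷ # 1 ∷ # 2 ∷ # 6 ∷ # 7 ∷ # 19 ∷ # 21 ∷ []) ∷
  (# 6 ∷ # 8 ∷ # 9 ∷ # 13 ∷ # 17 ∷ # 19 ∷ # 21 ∷ []) ∷
  (# 1 ∷ # 11 ∷ # 12 ∷ # 14 ∷ # 17 ∷ # 19 ∷ # 21 ∷ []) ∷
  (# 7 ∷ # 10 ∷ # 16 ∷ # 17 ∷ # 18 ∷ # 19 ∷ # 21 ∷ []) ∷
  (# 1 ∷ # 3 ∷ # 5 ∷ # 8 ∷ # 18 ∷ # 19 ∷ # 21 ∷ []) ∷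
  (# 2 ∷ # 4 ∷ # 11 ∷ # 13 ∷ # 18 ∷ # 19 ∷ # 21 ∷ []) ∷
  (# 8 ∷ # 9 ∷ # 11 ∷ # 14 ∷ # 16 ∷ # 18 ∷ # 21 ∷ []) ∷
  (# 1 ∷ # 6 ∷ # 12 ∷ # 13 ∷ # 16 ∷ # 18 ∷ # 21 ∷ []) ∷
  (# 0 ∷ # 2 ∷ # 5 ∷ # 15 ∷ # 16 ∷ # 18 ∷ # 21 ∷ []) ∷
  (# 3 ∷ # 9 ∷ # 10 ∷ # 13 ∷ # 15 ∷ # 18 ∷ # 21 ∷ []) ∷
  (# 4 ∷ # 5 ∷ # 6 ∷ # 7 ∷ # 9 ∷ # 18 ∷ # 21 ∷ []) ∷
  (# 2 ∷ # 3 ∷ # 7 ∷ # 12 ∷ # 14 ∷ # 18 ∷ # 21 ∷ []) ∷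
  (# 0 ∷ # 1 ∷ # 4 ∷ # 10 ∷ # 14 ∷ # 18 ∷ # 21 ∷ []) ∷
  (# 0 ∷ # 3 ∷ # 6 ∷ # 11 ∷ # 17 ∷ # 18 ∷ # 21 ∷ []) ∷
  (# 4 ∷ # 8 ∷ # 12 ∷ # 15 ∷ # 17 ∷ # 18 ∷ # 21 ∷ []) ∷
  (# 2 ∷ # 4 ∷ # 6 ∷ # 14 ∷ # 16 ∷ # 17 ∷ # 21 ∷ []) ∷
  (# 3 ∷ # 5 ∷ # 9 ∷ # 12 ∷ # 16 ∷ # 17 ∷ # 21 ∷ []) ∷
  (# 0 ∷ # 7 ∷ # 9 ∷ # 14 ∷ # 15 ∷ # 17 ∷ # 21 ∷ []) ∷
  (# 1 ∷ # 5 ∷ # 6 ∷ # 10 ∷ # 15 ∷ # 17 ∷ # 21 ∷ []) ∷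
  (# 0 ∷ # 2 ∷ # 10 ∷ # 12 ∷ # 13 ∷ # 17 ∷ # 21 ∷ []) ∷
  (# 1 ∷ # 3 ∷ # 4 ∷ # 7 ∷ # 13 ∷ # 17 ∷ # 21 ∷ []) ∷
  (# 2 ∷ # 5 ∷ # 7 ∷ # 8 ∷ # 11 ∷ # 17 ∷ # 21 ∷ []) ∷
  (# 6 ∷ # 7 ∷ # 10 ∷ # 11 ∷ # 13 ∷ # 14 ∷ # 21 ∷ []) ∷
  (# 0 ∷ # 5 ∷ # 6 ∷ # 8 ∷ # 12 ∷ # 14 ∷ # 21 ∷ []) ∷
  (# 0 ∷ # 2 ∷ # 3 ∷ # 4 ∷ # 8 ∷ # 9 ∷ # 21 ∷ []) ∷
  (# 1 ∷ # 7 ∷ # 8 ∷ # 9 ∷ # 10 ∷ # 12 ∷ # 21 ∷ []) ∷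
  (# 0 ∷ # 1 ∷ # 5 ∷ # 9 ∷ # 11 ∷ # 13 ∷ # 21 ∷ []) ∷
  (# 2 ∷ # 6 ∷ # 9 ∷ # 11 ∷ # 12 ∷ # 15 ∷ # 21 ∷ []) ∷
  (# 3 ∷ # 4 ∷ # 5 ∷ # 11 ∷ # 14 ∷ # 15 ∷ # 21 ∷ []) ∷
  (# 1 ∷ # 2 ∷ # 8 ∷ # 13 ∷ # 14 ∷ # 15 ∷ # 21 ∷ []) ∷
  (# 3 ∷ # 6 ∷ # 7 ∷ # 8 ∷ # 15 ∷ # 16 ∷ # 21 ∷ []) ∷
  (# 4 ∷ # 5 ∷ # 8 ∷ # 10 ∷ # 13 ∷ # 16 ∷ # 21 ∷ []) ∷
  (# 0 ∷ # 4 ∷ # 7 ∷ # 11 ∷ # 12 ∷ # 16 ∷ # 21 ∷ []) ∷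
  (# 1 ∷ # 2 ∷ # 3 ∷ # 10 ∷ # 11 ∷ # 16 ∷ # 21 ∷ []) ∷
  (# 11 ∷ # 13 ∷ # 15 ∷ # 16 ∷ # 17 ∷ # 21 ∷ # 22 ∷ []) ∷
  (# 3 ∷ # 8 ∷ # 10 ∷ # 14 ∷ # 17 ∷ # 21 ∷ # 22 ∷ []) ∷
  (# 2 ∷ # 4 ∷ # 7 ∷ # 10 ∷ # 15 ∷ # 21 ∷ # 22 ∷ []) ∷
  (# 0 ∷ # 1 ∷ # 3 ∷ # 12 ∷ # 15 ∷ # 21 ∷ # 22 ∷ []) ∷
  (# 4 ∷ # 9 ∷ # 12 ∷ # 13 ∷ # 14 ∷ # 21 ∷ # 22 ∷ []) ∷
  (# 1 ∷ # 4 ∷ # 6 ∷ # 8 ∷ # 11 ∷ # 21 ∷ # 22 ∷ []) ∷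
  (# 2 ∷ # 3 ∷ # 5 ∷ # 6 ∷ # 13 ∷ # 21 ∷ # 22 ∷ []) ∷
  (# 0 ∷ # 6 ∷ # 9 ∷ # 10 ∷ # 16 ∷ # 21 ∷ # 22 ∷ []) ∷
  (# 1 ∷ # 5 ∷ # 7 ∷ # 14 ∷ # 16 ∷ # 21 ∷ # 22 ∷ []) ∷
  (# 5 ∷ # 10 ∷ # 11 ∷ # 12 ∷ # 18 ∷ # 21 ∷ # 22 ∷ []) ∷
  (# 0 ∷ # 7 ∷ # 8 ∷ # 13 ∷ # 18 ∷ # 21 ∷ # 22 ∷ []) ∷
  (# 1 ∷ # 2 ∷ # 9 ∷ # 17 ∷ # 18 ∷ # 21 ∷ # 22 ∷ []) ∷
  (# 6 ∷ # 14 ∷ # 15 ∷ # 18 ∷ # 19 ∷ # 21 ∷ # 22 ∷ []) ∷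
  (# 2 ∷ # 8 ∷ # 12 ∷ # 16 ∷ # 19 ∷ # 21 ∷ # 22 ∷ []) ∷
  (# 3 ∷ # 7 ∷ # 9 ∷ # 11 ∷ # 19 ∷ # 21 ∷ # 22 ∷ []) ∷
  (# 0 ∷ # 4 ∷ # 5 ∷ # 17 ∷ # 19 ∷ # 21 ∷ # 22 ∷ []) ∷
  (# 1 ∷ # 10 ∷ # 13 ∷ # 19 ∷ # 20 ∷ # 21 ∷ # 22 ∷ []) ∷
  (# 3 ∷ # 4 ∷ # 16 ∷ # 18 ∷ # 20 ∷ # 21 ∷ # 22 ∷ []) ∷
  (# 5 ∷ # 8 ∷ # 9 ∷ # 15 ∷ # 20 ∷ # 21 ∷ # 22 ∷ []) ∷
  (# 0 ∷ # 2 ∷ # 11 ∷ # 14 ∷ # 20 ∷ # 21 ∷ # 22 ∷ []) ∷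
  (# 6 ∷ # 7 ∷ # 12 ∷ # 17 ∷ # 20 ∷ # 21 ∷ # 22 ∷ []) ∷
  (# 0 ∷ # 3 ∷ # 9 ∷ # 13 ∷ # 17 ∷ # 20 ∷ # 22 ∷ []) ∷
  (# 1 ∷ # 4 ∷ # 14 ∷ # 15 ∷ # 17 ∷ # 20 ∷ # 22 ∷ []) ∷
  (# 2 ∷ # 5 ∷ # 10 ∷ # 16 ∷ # 17 ∷ # 20 ∷ # 22 ∷ []) ∷
  (# 6 ∷ # 8 ∷ # 13 ∷ # 14 ∷ # 16 ∷ # 20 ∷ # 22 ∷ []) ∷
  (# 1 ∷ # 9 ∷ # 11 ∷ # 12 ∷ # 16 ∷ # 20 ∷ # 22 ∷ []) ∷
  (# 3 ∷ # 6 ∷ # 10 ∷ # 11 ∷ # 15 ∷ # 20 ∷ # 22 ∷ []) ∷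
  (# 4 ∷ # 5 ∷ # 7 ∷ # 11 ∷ # 13 ∷ # 20 ∷ # 22 ∷ []) ∷
  (# 0 ∷ # 4 ∷ # 8 ∷ # 10 ∷ # 12 ∷ # 20 ∷ # 22 ∷ []) ∷
  (# 1 ∷ # 2 ∷ # 3 ∷ # 7 ∷ # 8 ∷ # 20 ∷ # 22 ∷ []) ∷
  (# 7 ∷ # 9 ∷ # 10 ∷ # 14 ∷ # 18 ∷ # 20 ∷ # 22 ∷ []) ∷
  (# 0 ∷ # 1 ∷ # 5 ∷ # 6 ∷ # 18 ∷ # 20 ∷ # 22 ∷ []) ∷
  (# 2 ∷ # 12 ∷ # 13 ∷ # 15 ∷ # 18 ∷ # 20 ∷ # 22 ∷ []) ∷
  (# 8 ∷ # 11 ∷ # 17 ∷ # 18 ∷ # 19 ∷ # 20 ∷ # 22 ∷ []) ∷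
  (# 2 ∷ # 4 ∷ # 6 ∷ # 9 ∷ # 19 ∷ # 20 ∷ # 22 ∷ []) ∷
  (# 3 ∷ # 5 ∷ # 12 ∷ # 14 ∷ # 19 ∷ # 20 ∷ # 22 ∷ []) ∷
  (# 0 ∷ # 7 ∷ # 15 ∷ # 16 ∷ # 19 ∷ # 20 ∷ # 22 ∷ []) ∷
  (# 9 ∷ # 10 ∷ # 12 ∷ # 15 ∷ # 17 ∷ # 19 ∷ # 22 ∷ []) ∷
  (# 2 ∷ # 7 ∷ # 13 ∷ # 14 ∷ # 17 ∷ # 19 ∷ # 22 ∷ []) ∷
  (# 1 ∷ # 3 ∷ # 6 ∷ # 16 ∷ # 17 ∷ # 19 ∷ # 22 ∷ []) ∷
  (# 4 ∷ # 10 ∷ # 11 ∷ # 14 ∷ # 16 ∷ # 19 ∷ # 22 ∷ []) ∷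
  (# 5 ∷ # 6 ∷ # 7 ∷ # 8 ∷ # 10 ∷ # 19 ∷ # 22 ∷ []) ∷
  (# 0 ∷ # 6 ∷ # 11 ∷ # 12 ∷ # 13 ∷ # 19 ∷ # 22 ∷ []) ∷
  (# 0 ∷ # 1 ∷ # 8 ∷ # 9 ∷ # 14 ∷ # 19 ∷ # 22 ∷ []) ∷
  (# 3 ∷ # 4 ∷ # 8 ∷ # 13 ∷ # 15 ∷ # 19 ∷ # 22 ∷ []) ∷
  (# 1 ∷ # 2 ∷ # 5 ∷ # 11 ∷ # 15 ∷ # 19 ∷ # 22 ∷ []) ∷
  (# 0 ∷ # 2 ∷ # 3 ∷ # 10 ∷ # 18 ∷ # 19 ∷ # 22 ∷ []) ∷
  (# 1 ∷ # 4 ∷ # 7 ∷ # 12 ∷ # 18 ∷ # 19 ∷ # 22 ∷ []) ∷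
  (# 5 ∷ # 9 ∷ # 13 ∷ # 16 ∷ # 18 ∷ # 19 ∷ # 22 ∷ []) ∷
  (# 3 ∷ # 5 ∷ # 7 ∷ # 15 ∷ # 17 ∷ # 18 ∷ # 22 ∷ []) ∷
  (# 4 ∷ # 6 ∷ # 10 ∷ # 13 ∷ # 17 ∷ # 18 ∷ # 22 ∷ []) ∷
  (# 0 ∷ # 12 ∷ # 14 ∷ # 16 ∷ # 17 ∷ # 18 ∷ # 22 ∷ []) ∷
  (# 1 ∷ # 8 ∷ # 10 ∷ # 15 ∷ # 16 ∷ # 18 ∷ # 22 ∷ []) ∷
  (# 2 ∷ # 6 ∷ # 7 ∷ # 11 ∷ # 16 ∷ # 18 ∷ # 22 ∷ []) ∷
  (# 1 ∷ # 3 ∷ # 11 ∷ # 13 ∷ # 14 ∷ # 18 ∷ # 22 ∷ []) ∷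
  (# 2 ∷ # 4 ∷ # 5 ∷ # 8 ∷ # 14 ∷ # 18 ∷ # 22 ∷ []) ∷
  (# 3 ∷ # 6 ∷ # 8 ∷ # 9 ∷ # 12 ∷ # 18 ∷ # 22 ∷ []) ∷
  (# 0 ∷ # 4 ∷ # 9 ∷ # 11 ∷ # 15 ∷ # 18 ∷ # 22 ∷ []) ∷
  (# 7 ∷ # 8 ∷ # 11 ∷ # 12 ∷ # 14 ∷ # 15 ∷ # 22 ∷ []) ∷
  (# 0 ∷ # 5 ∷ # 10 ∷ # 13 ∷ # 14 ∷ # 15 ∷ # 22 ∷ []) ∷
  (# 1 ∷ # 6 ∷ # 7 ∷ # 9 ∷ # 13 ∷ # 15 ∷ # 22 ∷ []) ∷
  (# 0 ∷ # 2 ∷ # 5 ∷ # 7 ∷ # 9 ∷ # 12 ∷ # 22 ∷ []) ∷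
  (# 1 ∷ # 3 ∷ # 4 ∷ # 5 ∷ # 9 ∷ # 10 ∷ # 22 ∷ []) ∷
  (# 2 ∷ # 8 ∷ # 9 ∷ # 10 ∷ # 11 ∷ # 13 ∷ # 22 ∷ []) ∷
  (# 0 ∷ # 3 ∷ # 4 ∷ # 6 ∷ # 7 ∷ # 14 ∷ # 22 ∷ []) ∷
  (# 1 ∷ # 2 ∷ # 6 ∷ # 10 ∷ # 12 ∷ # 14 ∷ # 22 ∷ []) ∷
  (# 3 ∷ # 7 ∷ # 10 ∷ # 12 ∷ # 13 ∷ # 16 ∷ # 22 ∷ []) ∷
  (# 0 ∷ # 1 ∷ # 2 ∷ # 4 ∷ # 13 ∷ # 16 ∷ # 22 ∷ []) ∷
  (# 0 ∷ # 3 ∷ # 5 ∷ # 8 ∷ # 11 ∷ # 16 ∷ # 22 ∷ []) ∷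
  (# 4 ∷ # 5 ∷ # 6 ∷ # 12 ∷ # 15 ∷ # 16 ∷ # 22 ∷ []) ∷
  (# 2 ∷ # 3 ∷ # 9 ∷ # 14 ∷ # 15 ∷ # 16 ∷ # 22 ∷ []) ∷
  (# 4 ∷ # 7 ∷ # 8 ∷ # 9 ∷ # 16 ∷ # 17 ∷ # 22 ∷ []) ∷
  (# 5 ∷ # 6 ∷ # 9 ∷ # 11 ∷ # 14 ∷ # 17 ∷ # 22 ∷ []) ∷
  (# 1 ∷ # 5 ∷ # 8 ∷ # 12 ∷ # 13 ∷ # 17 ∷ # 22 ∷ []) ∷
  (# 2 ∷ # 3 ∷ # 4 ∷ # 11 ∷ # 12 ∷ # 17 ∷ # 22 ∷ []) ∷
  (# 0 ∷ # 1 ∷ # 7 ∷ # 10 ∷ # 11 ∷ # 17 ∷ # 22 ∷ []) ∷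
  (# 0 ∷ # 2 ∷ # 6 ∷ # 8 ∷ # 15 ∷ # 17 ∷ # 22 ∷ []) ∷
  []

derivPt : ℕ
derivPt = 22

contains22 : List (Fin 23) → Bool
contains22 [] = false
contains22 (i ∷ is) with toℕ i Data.Nat.≟ 22
... | yes _ = true
... | no  _ = contains22 is

dropPt : Fin 23 → List (Fin 22)
dropPt i with toℕ i <? 22
... | yes p = fromℕ< p ∷ []
... | no  _ = []

removePt : List (Fin 23) → List (Fin 22)
removePt = concatMap dropPt

derivedBlocks : List (List (Fin 22))
derivedBlocks = map removePt (filter (λ b → Data.Bool.T? (contains22 b)) wittBlocks)

sumℚ : List ℚ → ℚ
sumℚ = foldr _+_ 0ℚ

blockWeight : (Fin 22 → ℚ) → List (Fin 22) → ℚ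
blockWeight f B = sumℚ (map f B)

totalWeight : (Fin 22 → ℚ) → ℚ
totalWeight f = sumℚ (map f (allFin 22))

nonnegBlocks : (Fin 22 → ℚ) → ℕ
nonnegBlocks f = length (filter (λ B → 0ℚ ≤? blockWeight f B) derivedBlocks)

-- Take the 8-set S = {1,4,5,7,9,12,13,16} and weight its points 14 and the
-- other 14 points −8, so the total weight is 8·14 − 14·8 = 0.  A block (6
-- points) meeting S in j points then weighs 14j − 8(6 − j) = 22j − 48, which
-- is nonnegative exactly when j ≥ 3; only 14 of the 77 blocks meet S that often.
module Submission where

open import Defs
open import Data.Nat using (ℕ; _<_; _≤?_; z<s)
open import Data.Nat.Properties using (m<m+n)
open import Data.Fin using (Fin; #_)
import Data.Fin.Properties as Fin
open import Data.List using (List; []; _∷_; filter; length)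
open import Data.List.Membership.DecPropositional (Fin._≟_ {22}) using (_∈?_)
open import Data.Product using (∃; _×_; _,_)
open import Data.Rational using (ℚ; 0ℚ; _/_; -_)
import Data.Rational as ℚ
open import Data.Integer using (+_)
open import Data.Bool using (if_then_else_)
open import Relation.Nullary using (does)
open import Relation.Binary.PropositionalEquality using (_≡_; refl)

heavyPoints : List (Fin 22)
heavyPoints = # 1 ∷ # 4 ∷ # 5 ∷ # 7 ∷ # 9 ∷ # 12 ∷ # 13 ∷ # 16 ∷ []

weighting : Fin 22 → ℚ
weighting i = if does (i ∈? heavyPoints) then + 14 / 1 else - (+ 8 / 1)

heavyCount : List (Fin 22) → ℕ
heavyCount B = length (filter (_∈? heavyPoints) B)

weighting-balanced : totalWeight weighting ≡ 0ℚ
weighting-balanced = refl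

filter-nonnegative≡filter-heavyCount≥3 :
  filter (λ B → 0ℚ ℚ.≤? blockWeight weighting B) derivedBlocks
    ≡ filter (λ B → 3 ≤? heavyCount B) derivedBlocks
filter-nonnegative≡filter-heavyCount≥3 = refl

length-filter-heavyCount≥3 : length (filter (λ B → 3 ≤? heavyCount B) derivedBlocks) ≡ 14
length-filter-heavyCount≥3 = refl

lemma12 : ∃ λ (f : Fin 22 → ℚ) → (totalWeight f ≡ 0ℚ) × (nonnegBlocks f < 21)
lemma12 = weighting , weighting-balanced , nonnegBlocks<21
  where
  nonnegBlocks<21 : nonnegBlocks weighting < 21
  nonnegBlocks<21
    rewrite filter-nonnegative≡filter-heavyCount≥3 | length-filter-heavyCount≥3 = m<m+n 14 z<s
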